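{- Let $r_1\mid r_2\mid\cdots\mid r_n$ be positive integers, $p$ a prime dividing $r_n$, and $\vec\beta,\vec\beta'$ integer vectors with $0\le\beta_j,\beta'_j\le r_j-1$. Then $A_{\vec\beta,p}=A_{\vec\beta',p}$ if and only if there exists an integer $m$ with $1\le m\le p^{\max(0,\max_j(v_p(r_j)-v_p(\beta_j)))}$ and $\gcd(m,p)=1$ such that $\beta'_j\equiv m\beta_j\pmod{p^{v_p(r_j)}}$ for all $j=1,\dots,n$.
   Context: $v_p$ is the $p$-adic valuation with $v_p(0)=+\infty$ (so $v_p(r_j)-v_p(0)=-\infty$). Let $\mathcal R^\dagger_p=\{1,\dots,p^{v_p(r_1)}\}\times\cdots\times\{1,\dots,p^{v_p(r_n)}\}$ and for an integer vector $\vec\beta$ let $A_{\vec\beta,p}=\{\vec\omega\in\mathcal R^\dagger_p:\sum_{j=1}^np^{v_p(r_n)-v_p(r_j)}\omega_j\beta_j\equiv0\pmod{p^{v_p(r_n)}}\}$. -}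

module Defs where

open import Data.Nat using (ℕ; zero; suc; _+_; _*_; _∸_; _^_; _⊔_; _/_)
open import Data.Nat.Divisibility using (_∣?_)
open import Data.Fin using (Fin; zero; suc)
open import Data.Bool using (if_then_else_)
open import Relation.Nullary.Decidable using (does)

-- p-adic valuation of a natural number x, for x ≥ 1 and p ≥ 2.
-- Computed by repeated division with fuel x (x / p < x, so fuel x suffices).
-- Convention: for x = 0 it returns 0; the paper's v_p(0) = +∞ is handled
-- explicitly in the statement (see `expo`).
vp-go : ℕ → ℕ → ℕ → ℕ
vp-go p zero x = 0
vp-go zero (suc f) x = 0
vp-go (suc zero) (suc f) x = 0
vp-go (suc (suc q)) (suc f) zero = 0
vp-go (suc (suc q)) (suc f) (suc y) =
  if does (suc (suc q) ∣? suc y)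
  then suc (vp-go (suc (suc q)) f (suc y / suc (suc q)))
  else 0

vp : ℕ → ℕ → ℕ
vp p x = vp-go p x x

∑ : ∀ {n} → (Fin n → ℕ) → ℕ
∑ {zero} f = 0
∑ {suc n} f = f zero + ∑ (λ i → f (suc i))

⨆ : ∀ {n} → (Fin n → ℕ) → ℕ
⨆ {zero} f = 0
⨆ {suc n} f = f zero ⊔ ⨆ (λ i → f (suc i))

-- max(0, max_j (v_p(r_j) - v_p(β_j))), where terms with β_j = 0
-- are -∞ and hence contribute nothing.
expo : ∀ {n} → ℕ → (Fin n → ℕ) → (Fin n → ℕ) → ℕ
expo p r β = ⨆ (λ j → term (β j) (r j))
  where
  term : ℕ → ℕ → ℕ
  term zero _ = 0
  term (suc b) rj = vp p rj ∸ vp p (suc b)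

module Submission where

-- Put cⱼ = wⱼβⱼ and Q = p^V.  As wⱼ·p^v_p(rⱼ) = Q, whether Q ∣ ω·c depends only on
-- each ωⱼ modulo p^v_p(rⱼ), so A_β = A_β′ says that c and c′ have the same annihilator
-- modulo Q, while β′ ≡ mβ says that c′ ≡ m·c (mod Q).  All cⱼ are divisible by p^(V − e);
-- dividing it out leaves vectors a, a′ with the same annihilator modulo p^e, some aᵢ being
-- prime to p when e ≥ 1.  Testing with aᵢ·eⱼ − aⱼ·eᵢ makes all minors aᵢa′ⱼ − aⱼa′ᵢ vanish,
-- testing with p^(e−1)·eᵢ gives p ∤ a′ᵢ, so m = aᵢ⁻¹a′ᵢ is a unit with a′ ≡ m·a, which we
-- reduce into [1, p^e].  Conversely c′ ≡ m·c with m a unit gives Q ∣ ω·c′ ⇔ Q ∣ ω·c.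

open import Defs
open import Data.Nat as ℕ using (ℕ; zero; suc; z≤n; s≤s; NonZero)
import Data.Nat.Properties as ℕₚ
import Data.Nat.Divisibility as ℕ∣
open import Data.Nat.Coprimality as Coprime using (Coprime)
open import Data.Nat.GCD using (gcd)
open import Data.Nat.Primality using (Prime)
open import Data.Fin using (Fin; zero; suc; fromℕ; inject₁)
open import Data.Integer as ℤ using (ℤ; +_)
import Data.Integer.Properties as ℤₚ
open import Data.Integer.Divisibility using () renaming (_∣_ to _∣ℤ_)
open import Data.Integer.Divisibility.Signed using (_∣_; divides; ∣⇒∣ᵤ; ∣ᵤ⇒∣)
open import Data.Vec.Functional using (Vector)
open import Algebra.Properties.Semiring.Sum ℤₚ.+-*-semiring using (sum; sum-cong-≗)
open import Data.Product using (Σ; _×_; _,_; proj₁; proj₂)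
open import Data.Sum using (_⊎_; inj₁; inj₂)
open import Data.Empty using (⊥-elim)
open import Relation.Nullary using (¬_; yes; no)
open import Function.Bundles using (_⇔_; mk⇔; Equivalence)
open import Function.Construct.Symmetry using (⇔-sym)
import Function.Related.Propositional as Related
open import Relation.Binary.PropositionalEquality

module _ where
  open import Data.Integer using (0ℤ; _+_; _-_; _*_)
  open import Data.Integer.Divisibility.Signed using (∣m∣n⇒∣m+n)
  open import Data.Integer.Tactic.RingSolver using (solve-∀)
  open import Algebra.Properties.Semiring.Sum ℤₚ.+-*-semiring
    using (sum-replicate-zero; ∑-distrib-+; *-distribˡ-sum)

  infix 8 _·_
  _·_ : ∀ {n} → Vector ℤ n → Vector ℤ n → ℤ
  ω · a = sum (λ j → ω j * a j)

  basis : ∀ {n} → Fin n → ℤ → Vector ℤ n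
  basis zero    x zero    = x
  basis zero    x (suc l) = 0ℤ
  basis (suc i) x zero    = 0ℤ
  basis (suc i) x (suc l) = basis i x l

  ·-basis : ∀ {n} (i : Fin n) x (a : Vector ℤ n) → basis i x · a ≡ x * a i
  ·-basis {suc n} zero    x a = trans (cong (λ s → x * a zero + s) (sum-replicate-zero n)) (ℤₚ.+-identityʳ _)
  ·-basis {suc n} (suc i) x a = trans (ℤₚ.+-identityˡ _) (·-basis i x (λ l → a (suc l)))

  ·-+ : ∀ {n} (ω ω′ a : Vector ℤ n) → (λ j → ω j + ω′ j) · a ≡ ω · a + ω′ · a
  ·-+ ω ω′ a = trans (sum-cong-≗ (λ j → ℤₚ.*-distribʳ-+ (a j) (ω j) (ω′ j)))
                     (∑-distrib-+ (λ j → ω j * a j) (λ j → ω′ j * a j))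

  ·-scaleʳ : ∀ {n} (ω a : Vector ℤ n) d → ω · (λ j → d * a j) ≡ d * (ω · a)
  ·-scaleʳ ω a d = trans (sum-cong-≗ (λ j → swap (ω j) d (a j))) (sym (*-distribˡ-sum d (λ j → ω j * a j)))
    where
    swap : ∀ x d y → x * (d * y) ≡ d * (x * y)
    swap = solve-∀

  ∣-sum-difference : ∀ {n} {d} (f g : Vector ℤ n) → (∀ j → d ∣ f j - g j) → d ∣ sum f - sum g
  ∣-sum-difference {zero}  f g d∣f-g = divides 0ℤ refl
  ∣-sum-difference {suc n} {d} f g d∣f-g =
    subst (d ∣_) (regroup (f zero) (g zero) (sum (λ j → f (suc j))) (sum (λ j → g (suc j))))
      (∣m∣n⇒∣m+n (d∣f-g zero) (∣-sum-difference (λ j → f (suc j)) (λ j → g (suc j)) (λ j → d∣f-g (suc j))))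
    where
    regroup : ∀ x y s t → (x - y) + (s - t) ≡ (x + s) - (y + t)
    regroup = solve-∀

  +∑ : ∀ {n} (f : Fin n → ℕ) → + ∑ f ≡ sum (λ j → + f j)
  +∑ {zero}  f = refl
  +∑ {suc n} f = trans (ℤₚ.pos-+ (f zero) (∑ (λ j → f (suc j)))) (cong (λ s → + f zero + s) (+∑ (λ j → f (suc j))))

module _ where
  open import Data.Nat using (_^_; _≤_)
  open import Data.Integer using (-[1+_]; 1ℤ; _+_; _-_; _*_; -_)
  open import Data.Integer.Divisibility.Signed using (∣m∣n⇒∣m+n; ∣m∣n⇒∣m-n; *-cancelˡ-∣; *-monoʳ-∣)
  open import Data.Integer.DivMod using (_%ℕ_; _/ℕ_; n%ℕd<d; a≡a%ℕn+[a/ℕn]*n)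
  open import Data.Integer.Tactic.RingSolver using (solve-∀)
  open import Data.Nat.GCD using (module Bézout)
  import Data.Integer.Coprimality as ℤCoprime

  ∣-congruent : ∀ {d x y} → d ∣ x - y → d ∣ x ⇔ d ∣ y
  ∣-congruent {d} {x} {y} d∣x-y = mk⇔
    (λ d∣x → subst (d ∣_) (x-[x-y]≡y x y) (∣m∣n⇒∣m-n d∣x d∣x-y))
    (λ d∣y → subst (d ∣_) ([x-y]+y≡x x y) (∣m∣n⇒∣m+n d∣x-y d∣y))
    where
    x-[x-y]≡y : ∀ x y → x - (x - y) ≡ y
    x-[x-y]≡y = solve-∀
    [x-y]+y≡x : ∀ x y → (x - y) + y ≡ x
    [x-y]+y≡x = solve-∀

  *-∣-cancel : ∀ D {E X} .{{_ : ℤ.NonZero D}} → D * E ∣ D * X ⇔ E ∣ X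
  *-∣-cancel D = mk⇔ (*-cancelˡ-∣ D) (*-monoʳ-∣ D)

  representative : ∀ N .{{_ : NonZero N}} (x : ℤ) → Σ ℕ λ y → 1 ≤ y × y ≤ N × + N ∣ + y - x
  representative N x = suc R , s≤s z≤n , n%ℕd<d (x - 1ℤ) N , divides (- Q) (begin
      + suc R - x               ≡⟨ shift (+ R) x ⟩
      + R - (x - 1ℤ)            ≡⟨ cong (λ z → + R - z) (a≡a%ℕn+[a/ℕn]*n (x - 1ℤ) N) ⟩
      + R - (+ R + Q * + N)     ≡⟨ cancel (+ R) Q (+ N) ⟩
      - Q * + N                 ∎)
    where
    R = (x - 1ℤ) %ℕ N
    Q = (x - 1ℤ) /ℕ N
    open ≡-Reasoning
    shift : ∀ r x → (1ℤ + r) - x ≡ r - (x - 1ℤ)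
    shift = solve-∀
    cancel : ∀ r q n → r - (r + q * n) ≡ - q * n
    cancel = solve-∀

  coprime-^ : ∀ {u m} e → Coprime u m → Coprime u (m ^ e)
  coprime-^ zero    _   (_ , d∣1) = ℕ∣.∣1⇒≡1 d∣1
  coprime-^ {u} {m} (suc e) u⊥m {d} (d∣u , d∣m*mᵉ) =
    coprime-^ e u⊥m (d∣u , Coprime.coprime-divisor d⊥m d∣m*mᵉ)
    where
    d⊥m : Coprime d m
    d⊥m (c∣d , c∣m) = u⊥m (ℕ∣.∣-trans c∣d d∣u , c∣m)

  inverse-ℕ : ∀ {u N} → Coprime u N → Σ ℤ λ w → + N ∣ + u * w - 1ℤ
  inverse-ℕ {u} {N} u⊥N with Coprime.coprime-Bézout u⊥N
  ... | Bézout.+- x y 1+yN≡xu = + x , divides (+ y) (begin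
      + u * + x - 1ℤ            ≡⟨ cong (_- 1ℤ) (ℤₚ.*-comm (+ u) (+ x)) ⟩
      + x * + u - 1ℤ            ≡⟨ cong (_- 1ℤ) (ℤₚ.pos-* x u) ⟨
      + (x ℕ.* u) - 1ℤ          ≡⟨ cong (λ z → + z - 1ℤ) 1+yN≡xu ⟨
      + (1 ℕ.+ y ℕ.* N) - 1ℤ    ≡⟨ cong (λ z → 1ℤ + z - 1ℤ) (ℤₚ.pos-* y N) ⟩
      1ℤ + + y * + N - 1ℤ       ≡⟨ cancel (+ y * + N) ⟩
      + y * + N                 ∎)
    where
    open ≡-Reasoning
    cancel : ∀ z → 1ℤ + z - 1ℤ ≡ z
    cancel = solve-∀
  ... | Bézout.-+ x y 1+xu≡yN = - + x , divides (- + y) (begin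
      + u * - + x - 1ℤ          ≡⟨ rearrange (+ u) (+ x) ⟩
      - (1ℤ + + x * + u)        ≡⟨ cong (λ z → - (1ℤ + z)) (ℤₚ.pos-* x u) ⟨
      - + (1 ℕ.+ x ℕ.* u)       ≡⟨ cong (λ z → - + z) 1+xu≡yN ⟩
      - + (y ℕ.* N)             ≡⟨ cong -_ (ℤₚ.pos-* y N) ⟩
      - (+ y * + N)             ≡⟨ ℤₚ.neg-distribˡ-* (+ y) (+ N) ⟩
      - + y * + N               ∎)
    where
    open ≡-Reasoning
    rearrange : ∀ u x → u * - x - 1ℤ ≡ - (1ℤ + x * u)
    rearrange = solve-∀

  inverse : ∀ {u N} → Coprime ℤ.∣ u ∣ N → Σ ℤ λ w → + N ∣ u * w - 1ℤ
  inverse {+ n}        u⊥N = inverse-ℕ u⊥N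
  inverse { -[1+ n ] } {N} u⊥N =
    let w , N∣uw-1 = inverse-ℕ u⊥N in - w , subst (+ N ∣_) (sym (negate-both (+ suc n) w)) N∣uw-1
    where
    negate-both : ∀ x w → (- x) * (- w) - 1ℤ ≡ x * w - 1ℤ
    negate-both = solve-∀

  coprime-∣-cancel : ∀ {N m X} → Coprime N m → + N ∣ + m * X → + N ∣ X
  coprime-∣-cancel {N} {m} {X} N⊥m N∣mX =
    ∣ᵤ⇒∣ (ℤCoprime.coprime-divisor (+ N) (+ m) X N⊥m (∣⇒∣ᵤ N∣mX))

module _ where
  open import Data.Integer using (_*_)
  open import Data.Integer.Divisibility.Signed using (*-cancelʳ-∣)
  open import Data.Integer.Tactic.RingSolver using (solve-∀)

  SameAnnihilator : ∀ {n} → ℤ → Vector ℤ n → Vector ℤ n → Set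
  SameAnnihilator d a a′ = ∀ ω → d ∣ ω · a ⇔ d ∣ ω · a′

  divide-out : ∀ {n} D E .{{_ : ℤ.NonZero D}} .{{_ : ℤ.NonZero E}} {c c′ : Vector ℤ n} (a : Vector ℤ n) →
               (∀ j → c j ≡ D * a j) → SameAnnihilator (D * E) c c′ →
               Σ (Vector ℤ n) λ a′ → (∀ j → c′ j ≡ D * a′ j) × SameAnnihilator E a a′
  divide-out D E {c} {c′} a c≡Da same = a′ , c′≡Da′ , same′
    where
    -- D ∣ c′ j, tested with the vector E·e_j.
    D∣c′ : ∀ j → D ∣ c′ j
    D∣c′ j = *-cancelʳ-∣ E (subst (D * E ∣_) (trans (·-basis j E c′) (ℤₚ.*-comm E (c′ j)))
                              (Equivalence.to (same (basis j E)) DE∣Ec))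
      where
      rearrange : ∀ e d x → e * (d * x) ≡ x * (d * e)
      rearrange = solve-∀
      DE∣Ec : D * E ∣ basis j E · c
      DE∣Ec = divides (a j) (trans (·-basis j E c) (trans (cong (E *_) (c≡Da j)) (rearrange E D (a j))))
    a′ : Vector ℤ _
    a′ j = _∣_.quotient (D∣c′ j)
    c′≡Da′ : ∀ j → c′ j ≡ D * a′ j
    c′≡Da′ j = trans (_∣_.equality (D∣c′ j)) (ℤₚ.*-comm (a′ j) D)
    scaled : ∀ {b} b′ → (∀ j → b j ≡ D * b′ j) → ∀ ω → ω · b ≡ D * (ω · b′)
    scaled b′ b≡Db′ ω = trans (sum-cong-≗ (λ j → cong (ω j *_) (b≡Db′ j))) (·-scaleʳ ω b′ D)
    same′ : SameAnnihilator E a a′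
    same′ ω = begin
      E ∣ ω · a              ∼⟨ ⇔-sym (*-∣-cancel D) ⟩
      D * E ∣ D * (ω · a)    ≡⟨ cong (D * E ∣_) (scaled a c≡Da ω) ⟨
      D * E ∣ ω · c          ∼⟨ same ω ⟩
      D * E ∣ ω · c′         ≡⟨ cong (D * E ∣_) (scaled a′ c′≡Da′ ω) ⟩
      D * E ∣ D * (ω · a′)   ∼⟨ *-∣-cancel D ⟩
      E ∣ ω · a′             ∎
      where open Related.EquationalReasoning

-- The algebraic core: modulo a power of the prime p, equal annihilators mean proportionality.

module PrimeModulus {p : ℕ} (p-prime : Prime p) where
  open import Data.Nat using (_^_; _≤_)
  open import Data.Integer using (0ℤ; 1ℤ; _+_; _-_; _*_; -_)
  open import Data.Integer.Divisibility.Signed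
    using (∣m∣n⇒∣m+n; ∣m∣n⇒∣m-n; ∣n⇒∣m*n; ∣m⇒∣m*n; ∣-trans; *-cancelˡ-∣)
  open import Data.Integer.Tactic.RingSolver using (solve-∀)
  open import Data.Nat.Primality using (prime⇒irreducible; prime⇒nonTrivial; prime⇒nonZero; euclidsLemma)
  open import Data.Nat.GCD using (gcd-zeroˡ)

  instance
    p≢0 : NonZero p
    p≢0 = prime⇒nonZero p-prime

  pᵉ≢0 : ∀ e → NonZero (p ^ e)
  pᵉ≢0 e = ℕₚ.m^n≢0 p e

  pᵉ⁺¹≡pᵉ*p : ∀ e → + (p ^ suc e) ≡ + (p ^ e) * + p
  pᵉ⁺¹≡pᵉ*p e = trans (cong +_ (ℕₚ.*-comm p (p ^ e))) (ℤₚ.pos-* (p ^ e) p)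

  p∣pᵉ⁺¹ : ∀ e → + p ∣ + (p ^ suc e)
  p∣pᵉ⁺¹ e = divides (+ (p ^ e)) (pᵉ⁺¹≡pᵉ*p e)

  p∤⇒coprime : ∀ {u} → ¬ p ℕ∣.∣ u → Coprime u p
  p∤⇒coprime p∤u {d} (d∣u , d∣p) with prime⇒irreducible p-prime d∣p
  ... | inj₁ d≡1 = d≡1
  ... | inj₂ d≡p = ⊥-elim (p∤u (subst (ℕ∣._∣ _) d≡p d∣u))

  p∤1 : ¬ + p ∣ 1ℤ
  p∤1 p∣1 with ℕ∣.∣1⇒≡1 (∣⇒∣ᵤ p∣1) | ℕ.nonTrivial⇒n>1 p {{prime⇒nonTrivial p-prime}}
  ... | refl | s≤s ()

  euclid : ∀ x y → + p ∣ x * y → + p ∣ x ⊎ + p ∣ y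
  euclid x y p∣xy with euclidsLemma ℤ.∣ x ∣ ℤ.∣ y ∣ p-prime (subst (p ℕ∣.∣_) (ℤₚ.abs-* x y) (∣⇒∣ᵤ p∣xy))
  ... | inj₁ p∣x = inj₁ (∣ᵤ⇒∣ p∣x)
  ... | inj₂ p∣y = inj₂ (∣ᵤ⇒∣ p∣y)

  inverse-mod : ∀ {u} e → ¬ + p ∣ u → Σ ℤ λ w → + (p ^ e) ∣ u * w - 1ℤ
  inverse-mod {u} e p∤u = inverse {u} (coprime-^ e (p∤⇒coprime (λ p∣u → p∤u (∣ᵤ⇒∣ p∣u))))

  unit-multiple : ∀ {n} e (a a′ : Vector ℤ n) (i : Fin n) → ¬ + p ∣ a i →
                  SameAnnihilator (+ (p ^ suc e)) a a′ →
                  Σ ℤ λ m → ¬ + p ∣ m × ∀ j → + (p ^ suc e) ∣ a′ j - m * a j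
  unit-multiple e a a′ i p∤aᵢ same = w * a′ i , p∤m , a′≡ma
    where
    E = + (p ^ suc e)

    -- The minors a i·a′ j − a j·a′ i vanish, tested with the annihilator a i·e_j − a j·e_i of a.
    minor : ∀ j → E ∣ a i * a′ j - a j * a′ i
    minor j = subst (E ∣_) (pair a′)
                (Equivalence.to (same ω) (subst (E ∣_) (sym (trans (pair a) (cancel (a i) (a j)))) (divides 0ℤ refl)))
      where
      ω = λ l → basis j (a i) l + basis i (- a j) l
      neg-right : ∀ x y z t → x * y + (- z) * t ≡ x * y - z * t
      neg-right = solve-∀
      pair : ∀ b → ω · b ≡ a i * b j - a j * b i
      pair b = trans (·-+ (basis j (a i)) (basis i (- a j)) b)
                 (trans (cong₂ _+_ (·-basis j (a i) b) (·-basis i (- a j) b)) (neg-right (a i) (b j) (a j) (b i)))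
      cancel : ∀ x y → x * y - y * x ≡ 0ℤ
      cancel = solve-∀

    -- a′ i is prime to p: otherwise p^e·e_i would annihilate a′ but not a.
    p∤a′ᵢ : ¬ + p ∣ a′ i
    p∤a′ᵢ (divides t a′ᵢ≡tp) =
      p∤aᵢ (*-cancelˡ-∣ (+ (p ^ e)) {{pᵉ≢0 e}} (subst₂ _∣_ (pᵉ⁺¹≡pᵉ*p e) (·-basis i (+ (p ^ e)) a) E∣pᵉaᵢ))
      where
      rearrange : ∀ x t y → x * (t * y) ≡ t * (x * y)
      rearrange = solve-∀
      E∣pᵉaᵢ : E ∣ basis i (+ (p ^ e)) · a
      E∣pᵉaᵢ = Equivalence.from (same (basis i (+ (p ^ e)))) (divides t (begin
        basis i (+ (p ^ e)) · a′   ≡⟨ ·-basis i (+ (p ^ e)) a′ ⟩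
        + (p ^ e) * a′ i           ≡⟨ cong (+ (p ^ e) *_) a′ᵢ≡tp ⟩
        + (p ^ e) * (t * + p)      ≡⟨ rearrange (+ (p ^ e)) t (+ p) ⟩
        t * (+ (p ^ e) * + p)      ≡⟨ cong (t *_) (pᵉ⁺¹≡pᵉ*p e) ⟨
        t * E                      ∎))
        where open ≡-Reasoning

    w : ℤ
    w = proj₁ (inverse-mod (suc e) p∤aᵢ)
    E∣aᵢw-1 : E ∣ a i * w - 1ℤ
    E∣aᵢw-1 = proj₂ (inverse-mod (suc e) p∤aᵢ)

    -- m = w·a′ i is prime to p by Euclid's lemma, as both factors are.
    p∤m : ¬ + p ∣ w * a′ i
    p∤m p∣m with euclid w (a′ i) p∣m
    ... | inj₁ p∣w = p∤1 (subst (+ p ∣_) (cancel (a i * w))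
                        (∣m∣n⇒∣m-n (∣n⇒∣m*n (a i) p∣w) (∣-trans (p∣pᵉ⁺¹ e) E∣aᵢw-1)))
      where
      cancel : ∀ x → x - (x - 1ℤ) ≡ 1ℤ
      cancel = solve-∀
    ... | inj₂ p∣a′ᵢ = p∤a′ᵢ p∣a′ᵢ

    -- a′ j − w·a′ i·a j = −a′ j·(a i·w − 1) + w·(a i·a′ j − a j·a′ i).
    a′≡ma : ∀ j → E ∣ a′ j - w * a′ i * a j
    a′≡ma j = subst (E ∣_) (combine (a i) (a j) (a′ i) (a′ j) w)
                (∣m∣n⇒∣m+n (∣n⇒∣m*n (- a′ j) E∣aᵢw-1) (∣n⇒∣m*n w (minor j)))
      where
      combine : ∀ x y x′ y′ w → (- y′) * (x * w - 1ℤ) + w * (x * y′ - y * x′) ≡ y′ - w * x′ * y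
      combine = solve-∀

  bounded-multiple : ∀ {n} e (a a′ : Vector ℤ n) (m : ℤ) → ¬ + p ∣ m →
                     (∀ j → + (p ^ suc e) ∣ a′ j - m * a j) →
                     Σ ℕ λ m′ → 1 ≤ m′ × m′ ≤ p ^ suc e × gcd m′ p ≡ 1 ×
                                 ∀ j → + (p ^ suc e) ∣ a′ j - + m′ * a j
  bounded-multiple e a a′ m p∤m a′≡ma with representative (p ^ suc e) {{pᵉ≢0 (suc e)}} m
  ... | m′ , 1≤m′ , m′≤pᵉ , E∣m′-m = m′ , 1≤m′ , m′≤pᵉ , Coprime.coprime⇒gcd≡1 (p∤⇒coprime p∤m′) , a′≡m′a
    where
    -- m′ ≡ m modulo p^(1+e), hence modulo p.
    p∤m′ : ¬ p ℕ∣.∣ m′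
    p∤m′ p∣m′ = p∤m (Equivalence.to (∣-congruent (∣-trans (p∣pᵉ⁺¹ e) E∣m′-m))
                                    (∣ᵤ⇒∣ {k = + p} {i = + m′} p∣m′))
    shift : ∀ y x m m′ → (y - m * x) - (m′ - m) * x ≡ y - m′ * x
    shift = solve-∀
    a′≡m′a : ∀ j → + (p ^ suc e) ∣ a′ j - + m′ * a j
    a′≡m′a j = subst (+ (p ^ suc e) ∣_) (shift (a′ j) (a j) m (+ m′))
                 (∣m∣n⇒∣m-n (a′≡ma j) (∣m⇒∣m*n (a j) E∣m′-m))

  multiplier : ∀ {n} e (a a′ : Vector ℤ n) → SameAnnihilator (+ (p ^ e)) a a′ →
               (1 ≤ e → Σ (Fin n) λ i → ¬ + p ∣ a i) →
               Σ ℕ λ m → 1 ≤ m × m ≤ p ^ e × gcd m p ≡ 1 × ∀ j → + (p ^ e) ∣ a′ j - + m * a j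
  multiplier zero    a a′ same unit =
    1 , ℕₚ.≤-refl , ℕₚ.≤-refl , gcd-zeroˡ p , λ j → divides (a′ j - 1ℤ * a j) (sym (ℤₚ.*-identityʳ _))
  multiplier (suc e) a a′ same unit =
    let i , p∤aᵢ = unit (s≤s z≤n)
        m , p∤m , a′≡ma = unit-multiple e a a′ i p∤aᵢ same
    in bounded-multiple e a a′ m p∤m a′≡ma

module _ where
  open import Data.Nat using (_+_; _*_; _∸_; _^_; _≤_; _/_)
  open import Data.Nat.Divisibility using (divides; _∣?_; *-cancelˡ-∣)
  open import Data.Nat.DivMod using (m*n/n≡m)
  open import Data.Bool using (if_then_else_)
  open import Relation.Nullary.Decidable using (dec-true; dec-false)
  open import Data.Nat.Tactic.RingSolver using () renaming (solve-∀ to ℕ-solve-∀)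

  ^-∣ : ∀ m {a b} → a ≤ b → m ^ a ℕ∣.∣ m ^ b
  ^-∣ m {a} {b} a≤b = divides (m ^ (b ∸ a)) (begin
      m ^ b                 ≡⟨ cong (m ^_) (ℕₚ.m+[n∸m]≡n a≤b) ⟨
      m ^ (a + (b ∸ a))     ≡⟨ ℕₚ.^-distribˡ-+-* m a (b ∸ a) ⟩
      m ^ a * m ^ (b ∸ a)   ≡⟨ ℕₚ.*-comm (m ^ a) (m ^ (b ∸ a)) ⟩
      m ^ (b ∸ a) * m ^ a   ∎)
    where open ≡-Reasoning

  -- The valuation `vp` of Defs computes only for bases of the form 2 + q.
  module Valuation (q : ℕ) where

    p : ℕ
    p = suc (suc q)

    vp-go-divisible : ∀ f n → p ℕ∣.∣ suc n → vp-go p (suc f) (suc n) ≡ suc (vp-go p f (suc n / p))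
    vp-go-divisible f n p∣x =
      cong (λ b → if b then suc (vp-go p f (suc n / p)) else 0) (dec-true (p ∣? suc n) p∣x)

    vp-go-indivisible : ∀ f n → ¬ p ℕ∣.∣ suc n → vp-go p (suc f) (suc n) ≡ 0
    vp-go-indivisible f n p∤x =
      cong (λ b → if b then suc (vp-go p f (suc n / p)) else 0) (dec-false (p ∣? suc n) p∤x)

    -- Every x ≥ 1 factors as p ^ vp-go p fuel x * u with p ∤ u, provided the fuel
    -- dominates x (each division by p strictly shrinks x).
    vp-go-factor : ∀ fuel x → 1 ≤ x → x ≤ fuel → Σ ℕ λ u → x ≡ p ^ vp-go p fuel x * u × ¬ p ℕ∣.∣ u
    vp-go-factor (suc f) (suc n) _ x≤fuel with p ∣? suc n
    ... | no p∤x rewrite vp-go-indivisible f n p∤x = suc n , sym (ℕₚ.*-identityˡ (suc n)) , p∤x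
    ... | yes (divides zero x≡0) = ⊥-elim (ℕₚ.0≢1+n (sym x≡0))
    ... | yes p∣x@(divides z@(suc _) x≡zp)
      rewrite vp-go-divisible f n p∣x
      with vp-go-factor f z (s≤s z≤n)
             (ℕₚ.≤-pred (ℕₚ.≤-trans (ℕₚ.m<m*n z p (s≤s (s≤s z≤n))) (subst (_≤ suc f) x≡zp x≤fuel)))
    ... | u , z≡pᵉu , p∤u = u , x≡pᵉ⁺¹u , p∤u
      where
      e = vp-go p f z
      reorder : ∀ x u p → x * u * p ≡ p * x * u
      reorder = ℕ-solve-∀
      x≡pᵉ⁺¹u : suc n ≡ p ^ suc (vp-go p f (suc n / p)) * u
      x≡pᵉ⁺¹u = begin
        suc n               ≡⟨ x≡zp ⟩
        z * p               ≡⟨ cong (_* p) z≡pᵉu ⟩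
        p ^ e * u * p       ≡⟨ reorder (p ^ e) u p ⟩
        p ^ suc e * u       ≡⟨ cong (λ y → p ^ suc (vp-go p f y) * u) (trans (cong (_/ p) x≡zp) (m*n/n≡m z p)) ⟨
        p ^ suc (vp-go p f (suc n / p)) * u ∎
        where open ≡-Reasoning

    vp-factor : ∀ x → 1 ≤ x → Σ ℕ λ u → x ≡ p ^ vp p x * u × ¬ p ℕ∣.∣ u
    vp-factor x 1≤x = vp-go-factor x x 1≤x ℕₚ.≤-refl

    vp-greatest : ∀ {x} a → 1 ≤ x → p ^ a ℕ∣.∣ x → a ≤ vp p x
    vp-greatest {x} a 1≤x pᵃ∣x with a ℕₚ.≤? vp p x | vp-factor x 1≤x
    ... | yes a≤v | _ = a≤v
    ... | no a≰v | u , x≡pᵛu , p∤u =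
      ⊥-elim (p∤u (*-cancelˡ-∣ (p ^ vp p x) {{ℕₚ.m^n≢0 p (vp p x)}} pᵛ*p∣pᵛ*u))
      where
      pᵛ*p∣pᵛ*u : p ^ vp p x * p ℕ∣.∣ p ^ vp p x * u
      pᵛ*p∣pᵛ*u = subst₂ ℕ∣._∣_ (ℕₚ.*-comm p (p ^ vp p x)) x≡pᵛu (ℕ∣.∣-trans (^-∣ p (ℕₚ.≰⇒> a≰v)) pᵃ∣x)

    vp-mono : ∀ {x y} → 1 ≤ x → 1 ≤ y → x ℕ∣.∣ y → vp p x ≤ vp p y
    vp-mono {x} 1≤x 1≤y x∣y =
      let u , x≡pᵛu , _ = vp-factor x 1≤x
      in vp-greatest (vp p x) 1≤y (ℕ∣.∣-trans (divides u (trans x≡pᵛu (ℕₚ.*-comm _ u))) x∣y)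

module _ where
  open import Data.Nat using (_+_; _∸_; _⊔_; _≤_)

  ⨆-upper : ∀ {n} (f : Fin n → ℕ) j → f j ≤ ⨆ f
  ⨆-upper f zero    = ℕₚ.m≤m⊔n _ _
  ⨆-upper f (suc j) = ℕₚ.≤-trans (⨆-upper (λ i → f (suc i)) j) (ℕₚ.m≤n⊔m _ _)

  ⨆-least : ∀ {n} (f : Fin n → ℕ) {b} → (∀ j → f j ≤ b) → ⨆ f ≤ b
  ⨆-least {zero}  f f≤b = z≤n
  ⨆-least {suc n} f f≤b = ℕₚ.⊔-lub (f≤b zero) (⨆-least (λ i → f (suc i)) (λ i → f≤b (suc i)))

  ⨆-attained : ∀ {n} (f : Fin n → ℕ) → 1 ≤ ⨆ f → Σ (Fin n) λ i → f i ≡ ⨆ f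
  ⨆-attained {suc n} f 1≤⨆ with ℕₚ.⊔-sel (f zero) (⨆ (λ i → f (suc i)))
  ... | inj₁ ⨆≡f₀ = zero , sym ⨆≡f₀
  ... | inj₂ ⨆≡⨆tail =
    let i , fᵢ≡⨆tail = ⨆-attained (λ i → f (suc i)) (subst (1 ≤_) ⨆≡⨆tail 1≤⨆)
    in suc i , trans fᵢ≡⨆tail (sym ⨆≡⨆tail)

  ⨆-cong : ∀ {n} {f g : Fin n → ℕ} → (∀ j → f j ≡ g j) → ⨆ f ≡ ⨆ g
  ⨆-cong {zero}  f≡g = refl
  ⨆-cong {suc n} f≡g = cong₂ _⊔_ (f≡g zero) (⨆-cong (λ i → f≡g (suc i)))

  -- v_p(x) − v_p(b), read as 0 when b = 0 (where v_p(0) = ∞): the terms of `expo`.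
  depth : ℕ → ℕ → ℕ → ℕ
  depth p zero    x = 0
  depth p (suc b) x = vp p x ∸ vp p (suc b)

  depth≤vp : ∀ p b x → depth p b x ≤ vp p x
  depth≤vp p zero    x = z≤n
  depth≤vp p (suc b) x = ℕₚ.m∸n≤m (vp p x) (vp p (suc b))

  expo-unfold : ∀ {n} p (r β : Fin n → ℕ) → expo p r β ≡ ⨆ (λ j → depth p (β j) (r j))
  expo-unfold p r β = ⨆-cong agree
    where
    terms : Σ (Fin _ → ℕ) λ f → ⨆ f ≡ expo p r β
    terms = _ , refl
    agree : ∀ j → proj₁ terms j ≡ depth p (β j) (r j)
    agree j with β j
    ... | zero  = refl
    ... | suc b = refl

  chain-divides : ∀ k (r : Fin (suc k) → ℕ) → (∀ (i : Fin k) → r (inject₁ i) ℕ∣.∣ r (suc i)) →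
                  ∀ j → r j ℕ∣.∣ r (fromℕ k)
  chain-divides zero    r chain zero    = ℕ∣.∣-refl
  chain-divides (suc k) r chain zero    =
    ℕ∣.∣-trans (chain zero) (chain-divides k (λ i → r (suc i)) (λ i → chain (suc i)) zero)
  chain-divides (suc k) r chain (suc j) = chain-divides k (λ i → r (suc i)) (λ i → chain (suc i)) j

  ∸-∸-≡ : ∀ {V v s} → s ≤ v → v ≤ V → V ∸ (v ∸ s) ≡ (V ∸ v) + s
  ∸-∸-≡ {V} {v} {s} s≤v v≤V = begin
    V ∸ (v ∸ s)               ≡⟨ cong (_∸ (v ∸ s)) (ℕₚ.m∸n+n≡m v≤V) ⟨
    (V ∸ v) + v ∸ (v ∸ s)     ≡⟨ ℕₚ.+-∸-assoc (V ∸ v) (ℕₚ.m∸n≤m v s) ⟩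
    (V ∸ v) + (v ∸ (v ∸ s))   ≡⟨ cong (λ t → (V ∸ v) + t) (ℕₚ.m∸[m∸n]≡n s≤v) ⟩
    (V ∸ v) + s               ∎
    where open ≡-Reasoning

  ∸-∸-≤ : ∀ {V v} s → v ≤ V → V ∸ (v ∸ s) ≤ (V ∸ v) + s
  ∸-∸-≤ {V} {v} s v≤V with s ℕₚ.≤? v
  ... | yes s≤v = ℕₚ.≤-reflexive (∸-∸-≡ s≤v v≤V)
  ... | no s≰v  = begin
    V ∸ (v ∸ s)   ≡⟨ cong (V ∸_) (ℕₚ.m≤n⇒m∸n≡0 (ℕₚ.<⇒≤ (ℕₚ.≰⇒> s≰v))) ⟩
    V             ≡⟨ ℕₚ.m∸n+n≡m v≤V ⟨
    (V ∸ v) + v   ≤⟨ ℕₚ.+-monoʳ-≤ (V ∸ v) (ℕₚ.<⇒≤ (ℕₚ.≰⇒> s≰v)) ⟩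
    (V ∸ v) + s   ∎
    where open ℕₚ.≤-Reasoning

module Setting (q : ℕ) (p-prime : Prime (suc (suc q))) {n : ℕ} (r : Fin n → ℕ)
               (V : ℕ) (v≤V : ∀ j → vp (suc (suc q)) (r j) ℕ.≤ V) (β β′ : Fin n → ℕ) where
  open import Data.Nat using (_+_; _*_; _∸_; _^_; _≤_)
  open import Data.Integer using (_-_)
  open import Data.Integer.Divisibility.Signed using (∣n⇒∣m*n; *-monoʳ-∣)
  open import Data.Integer.Tactic.RingSolver using (solve-∀)
  open import Data.Nat.Tactic.RingSolver using () renaming (solve-∀ to ℕ-solve-∀)
  open Valuation q
  open PrimeModulus p-prime

  v : Fin n → ℕ
  v j = vp p (r j)

  weight : Fin n → ℕ
  weight j = p ^ (V ∸ v j)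

  Q : ℤ
  Q = + (p ^ V)

  coeff : Vector ℕ n → Vector ℤ n
  coeff b j = + (weight j * b j)

  ^-split : ∀ {a b} → a ≤ b → + (p ^ b) ≡ + (p ^ (b ∸ a)) ℤ.* + (p ^ a)
  ^-split {a} {b} a≤b = trans (cong (λ x → + (p ^ x)) (sym (ℕₚ.m∸n+n≡m a≤b)))
                          (trans (cong +_ (ℕₚ.^-distribˡ-+-* p (b ∸ a) a)) (ℤₚ.pos-* (p ^ (b ∸ a)) (p ^ a)))

  -- Q = weight j · p^(v j): a coordinate matters modulo Q only modulo p^(v j).
  Q≡weight*pᵛ : ∀ j → Q ≡ + weight j ℤ.* + (p ^ v j)
  Q≡weight*pᵛ j = ^-split (v≤V j)

  e : ℕ
  e = expo p r β

  BoxEquivalent : Set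
  BoxEquivalent = ∀ (ω : Fin n → ℕ) → (∀ j → 1 ≤ ω j × ω j ≤ p ^ vp p (r j)) →
    (p ^ V ℕ∣.∣ ∑ (λ j → p ^ (V ∸ vp p (r j)) * ω j * β j)) ⇔
    (p ^ V ℕ∣.∣ ∑ (λ j → p ^ (V ∸ vp p (r j)) * ω j * β′ j))

  Multiplier : (ℤ → ℤ → Set) → Set
  Multiplier divides′ = Σ ℕ λ m → 1 ≤ m × m ≤ p ^ e × gcd m p ≡ 1 ×
                                  ∀ j → divides′ (+ (p ^ v j)) (+ β′ j - + m ℤ.* + β j)

  sum-∣ : ∀ b (ω : Fin n → ℕ) → p ^ V ℕ∣.∣ ∑ (λ j → weight j * ω j * b j) ⇔ Q ∣ (λ j → + ω j) · coeff b
  sum-∣ b ω = mk⇔ (λ h → subst (Q ∣_) ∑≡· (∣ᵤ⇒∣ h)) (λ h → ∣⇒∣ᵤ (subst (Q ∣_) (sym ∑≡·) h))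
    where
    reorder : ∀ w x y → w * x * y ≡ x * (w * y)
    reorder = ℕ-solve-∀
    ∑≡· : + ∑ (λ j → weight j * ω j * b j) ≡ (λ j → + ω j) · coeff b
    ∑≡· = trans (+∑ (λ j → weight j * ω j * b j))
                (sum-cong-≗ (λ j → trans (cong +_ (reorder (weight j) (ω j) (b j))) (ℤₚ.pos-* (ω j) _)))

  reduce : ∀ b (ω ω′ : Vector ℤ n) → (∀ j → + (p ^ v j) ∣ ω j - ω′ j) → Q ∣ ω · coeff b - ω′ · coeff b
  reduce b ω ω′ ω≡ω′ = ∣-sum-difference _ _ term
    where
    factor : ∀ x y w b → x ℤ.* (w ℤ.* b) - y ℤ.* (w ℤ.* b) ≡ (x - y) ℤ.* (w ℤ.* b)
    factor = solve-∀
    rearrange : ∀ t p w b → t ℤ.* p ℤ.* (w ℤ.* b) ≡ t ℤ.* b ℤ.* (w ℤ.* p)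
    rearrange = solve-∀
    term : ∀ j → Q ∣ ω j ℤ.* coeff b j - ω′ j ℤ.* coeff b j
    term j with ω≡ω′ j
    ... | divides t ω-ω′≡tpᵛ = divides (t ℤ.* B) (begin
      ω j ℤ.* C - ω′ j ℤ.* C                 ≡⟨ cong (λ c → ω j ℤ.* c - ω′ j ℤ.* c) (ℤₚ.pos-* (weight j) (b j)) ⟩
      ω j ℤ.* (W ℤ.* B) - ω′ j ℤ.* (W ℤ.* B) ≡⟨ factor (ω j) (ω′ j) W B ⟩
      (ω j - ω′ j) ℤ.* (W ℤ.* B)             ≡⟨ cong (ℤ._* (W ℤ.* B)) ω-ω′≡tpᵛ ⟩
      t ℤ.* Pᵛ ℤ.* (W ℤ.* B)                 ≡⟨ rearrange t Pᵛ W B ⟩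
      t ℤ.* B ℤ.* (W ℤ.* Pᵛ)                 ≡⟨ cong (t ℤ.* B ℤ.*_) (Q≡weight*pᵛ j) ⟨
      t ℤ.* B ℤ.* Q                          ∎)
      where
      open ≡-Reasoning
      C = coeff b j
      W = + weight j
      B = + b j
      Pᵛ = + (p ^ v j)

  -- The box condition says that coeff β and coeff β′ have the same annihilator modulo Q,
  -- since every integer vector is coordinatewise congruent to one in the box.
  box⇒same : BoxEquivalent → SameAnnihilator Q (coeff β) (coeff β′)
  box⇒same box ω = begin
    Q ∣ ω · coeff β                              ∼⟨ ⇔-sym (∣-congruent (reduce β ω̂ ω ω̂≡ω)) ⟩
    Q ∣ ω̂ · coeff β                              ∼⟨ ⇔-sym (sum-∣ β ω̂ℕ) ⟩
    p ^ V ℕ∣.∣ ∑ (λ j → weight j * ω̂ℕ j * β j)   ∼⟨ box ω̂ℕ in-box ⟩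
    p ^ V ℕ∣.∣ ∑ (λ j → weight j * ω̂ℕ j * β′ j)  ∼⟨ sum-∣ β′ ω̂ℕ ⟩
    Q ∣ ω̂ · coeff β′                             ∼⟨ ∣-congruent (reduce β′ ω̂ ω ω̂≡ω) ⟩
    Q ∣ ω · coeff β′                             ∎
    where
    open Related.EquationalReasoning
    rep : ∀ j → Σ ℕ λ y → 1 ≤ y × y ≤ p ^ v j × + (p ^ v j) ∣ + y - ω j
    rep j = representative (p ^ v j) {{ℕₚ.m^n≢0 p (v j)}} (ω j)
    ω̂ℕ : Fin n → ℕ
    ω̂ℕ j = proj₁ (rep j)
    in-box : ∀ j → 1 ≤ ω̂ℕ j × ω̂ℕ j ≤ p ^ v j
    in-box j = proj₁ (proj₂ (rep j)) , proj₁ (proj₂ (proj₂ (rep j)))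
    ω̂ : Vector ℤ n
    ω̂ j = + ω̂ℕ j
    ω̂≡ω : ∀ j → + (p ^ v j) ∣ ω̂ j - ω j
    ω̂≡ω j = proj₂ (proj₂ (proj₂ (rep j)))

  lift-congruence : ∀ m j → + (p ^ v j) ∣ + β′ j - + m ℤ.* + β j ⇔ Q ∣ coeff β′ j - + m ℤ.* coeff β j
  lift-congruence m j = begin
    + (p ^ v j) ∣ X                     ∼⟨ ⇔-sym (*-∣-cancel W {{ℕₚ.m^n≢0 p (V ∸ v j)}}) ⟩
    W ℤ.* + (p ^ v j) ∣ W ℤ.* X         ≡⟨ cong₂ _∣_ (Q≡weight*pᵛ j) expand ⟨
    Q ∣ coeff β′ j - + m ℤ.* coeff β j  ∎
    where
    open Related.EquationalReasoning
    W = + weight j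
    X = + β′ j - + m ℤ.* + β j
    distribute : ∀ w b′ m b → w ℤ.* b′ - m ℤ.* (w ℤ.* b) ≡ w ℤ.* (b′ - m ℤ.* b)
    distribute = solve-∀
    expand : coeff β′ j - + m ℤ.* coeff β j ≡ W ℤ.* X
    expand = trans (cong₂ (λ x y → x - + m ℤ.* y) (ℤₚ.pos-* (weight j) (β′ j)) (ℤₚ.pos-* (weight j) (β j)))
                   (distribute W (+ β′ j) (+ m) (+ β j))

  -- Conversely, a multiplier m prime to p relating β′ to β gives the box condition:
  -- ω · coeff β′ ≡ m·(ω · coeff β) modulo Q, and m is invertible modulo Q.
  congruent⇒box : ∀ m → gcd m p ≡ 1 → (∀ j → + (p ^ v j) ∣ + β′ j - + m ℤ.* + β j) → BoxEquivalent
  congruent⇒box m gcd≡1 β′≡mβ ω _ = begin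
    p ^ V ℕ∣.∣ ∑ (λ j → weight j * ω j * β j)    ∼⟨ sum-∣ β ω ⟩
    Q ∣ ω̂ · coeff β                              ∼⟨ unit-factor ⟩
    Q ∣ + m ℤ.* (ω̂ · coeff β)                    ∼⟨ ⇔-sym (∣-congruent ω̂c′≡mω̂c) ⟩
    Q ∣ ω̂ · coeff β′                             ∼⟨ ⇔-sym (sum-∣ β′ ω) ⟩
    p ^ V ℕ∣.∣ ∑ (λ j → weight j * ω j * β′ j)   ∎
    where
    open Related.EquationalReasoning
    ω̂ : Vector ℤ n
    ω̂ j = + ω j
    unit-factor : Q ∣ ω̂ · coeff β ⇔ Q ∣ + m ℤ.* (ω̂ · coeff β)
    unit-factor = mk⇔ (∣n⇒∣m*n (+ m))
                      (coprime-∣-cancel (Coprime.sym (coprime-^ V (Coprime.gcd≡1⇒coprime {m} gcd≡1))))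
    distribute : ∀ w c′ m c → w ℤ.* (c′ - m ℤ.* c) ≡ w ℤ.* c′ - w ℤ.* (m ℤ.* c)
    distribute = solve-∀
    ω̂c′≡mω̂c : Q ∣ ω̂ · coeff β′ - + m ℤ.* (ω̂ · coeff β)
    ω̂c′≡mω̂c = subst (λ z → Q ∣ ω̂ · coeff β′ - z) (·-scaleʳ ω̂ (coeff β) (+ m))
      (∣-sum-difference _ _ (λ j → subst (Q ∣_) (distribute (ω̂ j) (coeff β′ j) (+ m) (coeff β j))
        (∣n⇒∣m*n (ω̂ j) (Equivalence.to (lift-congruence m j) (β′≡mβ j)))))

  weighted-factor : ∀ j x → 1 ≤ x → Σ ℕ λ u → weight j * x ≡ p ^ ((V ∸ v j) + vp p x) * u × ¬ p ℕ∣.∣ u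
  weighted-factor j x 1≤x = let u , x≡pˢu , p∤u = vp-factor x 1≤x in u , (begin
    weight j * x                          ≡⟨ cong (weight j *_) x≡pˢu ⟩
    weight j * (p ^ vp p x * u)           ≡⟨ ℕₚ.*-assoc (weight j) (p ^ vp p x) u ⟨
    weight j * p ^ vp p x * u             ≡⟨ cong (_* u) (ℕₚ.^-distribˡ-+-* p (V ∸ v j) (vp p x)) ⟨
    p ^ ((V ∸ v j) + vp p x) * u          ∎) , p∤u
    where open ≡-Reasoning

  depth≤e : ∀ j → depth p (β j) (r j) ≤ e
  depth≤e j = subst (depth p (β j) (r j) ≤_) (sym (expo-unfold p r β)) (⨆-upper (λ i → depth p (β i) (r i)) j)

  e≤V : e ≤ V
  e≤V = subst (_≤ V) (sym (expo-unfold p r β))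
          (⨆-least (λ i → depth p (β i) (r i)) (λ j → ℕₚ.≤-trans (depth≤vp p (β j) (r j)) (v≤V j)))

  coeff-divisible : ∀ j → p ^ (V ∸ e) ℕ∣.∣ weight j * β j
  coeff-divisible j = divisible (β j) refl
    where
    divisible : ∀ b → β j ≡ b → p ^ (V ∸ e) ℕ∣.∣ weight j * b
    divisible zero    _    = subst (p ^ (V ∸ e) ℕ∣.∣_) (sym (ℕₚ.*-zeroʳ (weight j))) (ℕ∣._∣0 (p ^ (V ∸ e)))
    divisible (suc b) βⱼ≡b =
      let u , eq , _ = weighted-factor j (suc b) (s≤s z≤n)
          bound = ℕₚ.≤-trans (ℕₚ.∸-monoʳ-≤ V (subst (λ x → depth p x (r j) ≤ e) βⱼ≡b (depth≤e j)))
                             (∸-∸-≤ (vp p (suc b)) (v≤V j))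
      in subst (p ^ (V ∸ e) ℕ∣.∣_) (sym eq) (ℕ∣.∣-trans (^-∣ p bound) (ℕ∣.m∣m*n u))

  coeff-unit : 1 ≤ e → Σ (Fin n) λ i → Σ ℕ λ u → weight i * β i ≡ p ^ (V ∸ e) * u × ¬ p ℕ∣.∣ u
  coeff-unit 1≤e =
    let i , depthᵢ≡ = ⨆-attained (λ j → depth p (β j) (r j)) (subst (1 ≤_) (expo-unfold p r β) 1≤e)
    in i , unit-at i (β i) (trans depthᵢ≡ (sym (expo-unfold p r β)))
    where
    unit-at : ∀ i b → depth p b (r i) ≡ e → Σ ℕ λ u → weight i * b ≡ p ^ (V ∸ e) * u × ¬ p ℕ∣.∣ u
    unit-at i zero    depth≡e = ⊥-elim (ℕₚ.<⇒≢ 1≤e depth≡e)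
    unit-at i (suc b) depth≡e =
      let u , eq , p∤u = weighted-factor i (suc b) (s≤s z≤n)
          s<vᵢ = ℕₚ.m∸n≢0⇒n<m (λ d≡0 → ℕₚ.<⇒≢ 1≤e (trans (sym d≡0) depth≡e))
          exponent = trans (cong (V ∸_) (sym depth≡e)) (∸-∸-≡ (ℕₚ.<⇒≤ s<vᵢ) (v≤V i))
      in u , trans eq (cong (λ x → p ^ x * u) (sym exponent)) , p∤u

  -- Equal annihilators force a multiplier: divide the coefficients by p^(V ∸ e) and
  -- apply `multiplier` modulo p^e.
  same⇒congruent : SameAnnihilator Q (coeff β) (coeff β′) → Multiplier _∣_
  same⇒congruent same =
    let a′ , c′≡Da′ , same′ = divide-out D E {{D≢0}} {{E≢0}} a c≡Da
                                (subst (λ d → SameAnnihilator d (coeff β) (coeff β′)) (^-split e≤V) same)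
        m , 1≤m , m≤pᵉ , gcd≡1 , a′≡ma = multiplier e a a′ same′ unit
    in m , 1≤m , m≤pᵉ , gcd≡1 , λ j → Equivalence.from (lift-congruence m j)
         (subst₂ _∣_ (sym (^-split e≤V)) (scale {m = + m} (c′≡Da′ j) (c≡Da j)) (*-monoʳ-∣ D (a′≡ma j)))
    where
    D = + (p ^ (V ∸ e))
    E = + (p ^ e)
    D≢0 = ℕₚ.m^n≢0 p (V ∸ e)
    E≢0 = ℕₚ.m^n≢0 p e
    D∣c : ∀ j → D ∣ coeff β j
    D∣c j = ∣ᵤ⇒∣ (coeff-divisible j)
    a : Vector ℤ n
    a j = _∣_.quotient (D∣c j)
    c≡Da : ∀ j → coeff β j ≡ D ℤ.* a j
    c≡Da j = trans (_∣_.equality (D∣c j)) (ℤₚ.*-comm (a j) D)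
    unit : 1 ≤ e → Σ (Fin n) λ i → ¬ + p ∣ a i
    unit 1≤e =
      let i , u , cᵢ≡pᵘ , p∤u = coeff-unit 1≤e
          aᵢ≡u = ℤₚ.*-cancelˡ-≡ D (a i) (+ u) {{D≢0}}
                   (trans (sym (c≡Da i)) (trans (cong +_ cᵢ≡pᵘ) (ℤₚ.pos-* (p ^ (V ∸ e)) u)))
      in i , λ p∣aᵢ → p∤u (∣⇒∣ᵤ (subst (+ p ∣_) aᵢ≡u p∣aᵢ))
    distribute : ∀ d x′ m x → d ℤ.* (x′ - m ℤ.* x) ≡ d ℤ.* x′ - m ℤ.* (d ℤ.* x)
    distribute = solve-∀
    scale : ∀ {c′ c x′ x} {m : ℤ} → c′ ≡ D ℤ.* x′ → c ≡ D ℤ.* x → D ℤ.* (x′ - m ℤ.* x) ≡ c′ - m ℤ.* c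
    scale {m = m} refl refl = distribute D _ m _

  box⇔multiplier : BoxEquivalent ⇔ Multiplier _∣ℤ_
  box⇔multiplier = mk⇔ (λ box → unsigned (same⇒congruent (box⇒same box))) signed
    where
    unsigned : Multiplier _∣_ → Multiplier _∣ℤ_
    unsigned (m , 1≤m , m≤pᵉ , gcd≡1 , β′≡mβ) = m , 1≤m , m≤pᵉ , gcd≡1 , λ j → ∣⇒∣ᵤ (β′≡mβ j)
    signed : Multiplier _∣ℤ_ → BoxEquivalent
    signed (m , _ , _ , gcd≡1 , β′≡mβ) = congruent⇒box m gcd≡1 (λ j → ∣ᵤ⇒∣ (β′≡mβ j))

module _ where
  open import Data.Nat using (_*_; _∸_; _^_; _≤_; _<_)
  open import Data.Nat.Primality using (¬prime[0]; ¬prime[1])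

  lemma4p8 : (k : ℕ) (r : Fin (suc k) → ℕ) (p : ℕ) (β β′ : Fin (suc k) → ℕ) →
      (∀ j → 1 ≤ r j) →
      (∀ (i : Fin k) → r (inject₁ i) ℕ∣.∣ r (Data.Fin.suc i)) →
      Prime p →
      p ℕ∣.∣ r (fromℕ k) →
      (∀ j → β j < r j) →
      (∀ j → β′ j < r j) →
      ((∀ (ω : Fin (suc k) → ℕ) → (∀ j → 1 ≤ ω j × ω j ≤ p ^ vp p (r j)) →
          (p ^ vp p (r (fromℕ k)) ℕ∣.∣
             ∑ (λ j → p ^ (vp p (r (fromℕ k)) ∸ vp p (r j)) * ω j * β j))
          ⇔
          (p ^ vp p (r (fromℕ k)) ℕ∣.∣
             ∑ (λ j → p ^ (vp p (r (fromℕ k)) ∸ vp p (r j)) * ω j * β′ j)))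
       ⇔
       Σ ℕ (λ m → 1 ≤ m × m ≤ p ^ expo p r β × gcd m p ≡ 1 ×
          (∀ j → (+ (p ^ vp p (r j)) ∣ℤ ((+ β′ j) ℤ.- (+ m) ℤ.* (+ β j))))))
  lemma4p8 k r 0 β β′ _ _ p-prime _ _ _ = ⊥-elim (¬prime[0] p-prime)
  lemma4p8 k r 1 β β′ _ _ p-prime _ _ _ = ⊥-elim (¬prime[1] p-prime)
  lemma4p8 k r (suc (suc q)) β β′ r≥1 chain p-prime _ _ _ =
    Setting.box⇔multiplier q p-prime r (vp p (r (fromℕ k))) vⱼ≤vₙ β β′
    where
    open Valuation q using (p; vp-mono)
    vⱼ≤vₙ : ∀ j → vp p (r j) ≤ vp p (r (fromℕ k))
    vⱼ≤vₙ j = vp-mono (r≥1 j) (r≥1 (fromℕ k)) (chain-divides k r chain j)
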